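{- If $p \equiv 1 \pmod 6$ is prime such that $2, 3, 6 \notin (\mathbb{Z}_p^*)^3$, then there is a factorisation of $K_p$ into $\mathrm{Cay}(\mathbb{Z}_p; \pm\{1, 3, 4\})$.
   Context: $(\mathbb{Z}_p^*)^3=\{x^3 : x\in\mathbb{Z}_p^*\}$, the subgroup of cubes in the unit group modulo $p$. For a group $G$ and a subset $S \subseteq G$ not containing the identity and closed under inverses, the Cayley graph $\mathrm{Cay}(G;S)$ has vertex set $G$, with $g$ adjacent to $g s$ for each $s \in S$. $\pm\{a_1,\dots,a_s\}$ denotes $\{\pm a_1,\dots,\pm a_s\}$. A factorisation of a graph into $H$ is a decomposition of its edge set into edge-disjoint spanning subgraphs each isomorphic to $H$. -}

module Defs where

open import Level using (0ℓ)
open import Data.Nat using (ℕ; _+_; _*_; NonZero)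
open import Data.Nat.DivMod using (_%_)
open import Data.Fin using (Fin; toℕ)
open import Data.List using (List; _∷_; [])
open import Data.List.Membership.Propositional using (_∈_)
open import Data.Product using (Σ; ∃; ∃-syntax; _×_; _,_)
open import Data.Sum using (_⊎_)
open import Function.Bundles using (_↔_; _⇔_; Inverse)
open import Relation.Binary.PropositionalEquality using (_≡_; _≢_)

Graph : ℕ → Set₁
Graph n = Fin n → Fin n → Set

_≡[mod_]_ : ℕ → (p : ℕ) → .{{NonZero p}} → ℕ → Set
a ≡[mod p ] b = a % p ≡ b % p

IsUnitCube : (p : ℕ) → .{{NonZero p}} → ℕ → Set
IsUnitCube p a = ∃[ x ] ((x % p ≢ 0) × ((x * x * x) ≡[mod p ] a))

-- Cay(ℤ_p ; ±S): x adjacent to x + s and x - s for each s ∈ S.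
Cay : (p : ℕ) → .{{NonZero p}} → List ℕ → Graph p
Cay p S x y = ∃[ s ] (s ∈ S × (((toℕ x + s) ≡[mod p ] toℕ y) ⊎ ((toℕ y + s) ≡[mod p ] toℕ x)))

_≅_ : {n : ℕ} → Graph n → Graph n → Set
_≅_ {n} G H = Σ (Fin n ↔ Fin n) λ f →
  ∀ x y → G x y ⇔ H (Inverse.to f x) (Inverse.to f y)

-- A factorisation of K_n into H: a family of spanning subgraphs of K_n
-- (graphs on the full vertex set Fin n), each isomorphic to H, such that every
-- edge {u,v} (u ≢ v) of K_n lies in exactly one of them, and no factor has
-- loops (so all edges are edges of K_n).
Factorisation : (n : ℕ) → Graph n → Set₁
Factorisation n H = Σ ℕ λ k → Σ (Fin k → Graph n) λ F →
  (∀ i → F i ≅ H) ×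
  (∀ i u → ¬' (F i u u)) ×
  (∀ u v → u ≢ v → Σ (Fin k) λ i → F i u v × (∀ j → F j u v → j ≡ i))
  where
  open import Relation.Nullary using () renaming (¬_ to ¬')

-- The cubes C form a subgroup of ℤ_p^* of index at most 3: x ↦ x³ is at most 3-to-1
-- (x³ = 1 has at most three roots), so nine pairwise distinct classes aⁱbʲC cannot fit
-- into ℤ_p^*. As 2, 3 and 6 are non-cubes, 2 and 3 lie in the same non-trivial class,
-- hence 1, 3 and 4 = 2² represent the three classes; moreover -1 = (-1)³ ∈ C. So every
-- non-zero difference v - u is ±m·t for a unique cube m < p/2 and a unique t ∈ {1, 3, 4},
-- and the factors are the dilates m·Cay(ℤ_p; ±{1, 3, 4}), isomorphic to Cay(ℤ_p; ±{1, 3, 4})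
-- via x ↦ m⁻¹x.

module Submission where

open import Defs
open import Level using (0ℓ)
open import Data.Nat
open import Data.Nat.Properties
open import Data.Nat.DivMod
open import Data.Nat.Divisibility using (_∣_; divides; m%n≡0⇒n∣m; n∣m⇒m%n≡0)
open import Data.Nat.Primality using (Prime; euclidsLemma; prime⇒nonTrivial)
open import Data.Nat.Coprimality using (prime⇒coprime; coprime-Bézout)
open import Data.Nat.GCD using (module Bézout)
open import Data.Nat.Tactic.RingSolver using (solve-∀)
open import Data.Fin using (Fin; zero; suc; toℕ; fromℕ<; combine; remQuot)
open import Data.Fin.Patterns using (0F; 1F; 2F)
open import Data.Fin.Properties using (any?; toℕ-fromℕ<; toℕ<n; toℕ-injective; combine-remQuot; combine-injective; injective⇒≤)
open import Data.Product
open import Data.List using (List; _∷_; []; filter; upTo; length; lookup)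
open import Data.List.Membership.Propositional using (_∈_)
open import Data.List.Membership.Propositional.Properties using (∈-filter⁺; ∈-filter⁻; ∈-upTo⁺; ∈-lookup)
import Data.List.Relation.Unary.All as All
open import Data.List.Relation.Unary.AllPairs using (_∷_)
open import Data.List.Relation.Unary.Any using (here; there; index)
open import Data.List.Relation.Unary.Any.Properties using (lookup-index)
open import Data.List.Relation.Unary.Unique.Propositional using (Unique)
import Data.List.Relation.Unary.Unique.Propositional.Properties as Unique
open import Algebra.Properties.CommutativeSemigroup *-commutativeSemigroup using () renaming (interchange to *-interchange)
open import Data.Sum using (_⊎_; inj₁; inj₂; [_,_]′)
open import Function using (_∘_; id; flip)
open import Function.Bundles using (mk⇔; mk↔ₛ′)
open import Relation.Nullary
open import Data.Empty using (⊥; ⊥-elim)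
open import Relation.Nullary.Decidable using (map′; _×-dec_)
open import Relation.Binary.Bundles using (Setoid)
open import Relation.Binary.PropositionalEquality

cube : ℕ → ℕ
cube x = x * x * x

^1 : ∀ c → c ^ 1 ≡ c
^1 = *-identityʳ

^2 : ∀ c → c ^ 2 ≡ c * c
^2 c = cong (c *_) (*-identityʳ c)

cube-* : ∀ x y → cube (x * y) ≡ cube x * cube y
cube-* = expand
  where
  expand : ∀ x y → x * y * (x * y) * (x * y) ≡ x * x * x * (y * y * y)
  expand = solve-∀

^-split-mod-3 : ∀ c x → c ^ x ≡ c ^ (x % 3) * cube (c ^ (x / 3))
^-split-mod-3 c x = begin
  c ^ x                              ≡⟨ cong (c ^_) (m≡m%n+[m/n]*n x 3) ⟩
  c ^ (x % 3 + x / 3 * 3)            ≡⟨ ^-distribˡ-+-* c (x % 3) (x / 3 * 3) ⟩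
  c ^ (x % 3) * c ^ (x / 3 * 3)      ≡⟨ cong (c ^ (x % 3) *_) (^-*-assoc c (x / 3) 3) ⟨
  c ^ (x % 3) * (c ^ (x / 3)) ^ 3    ≡⟨ cong (c ^ (x % 3) *_) (^3≡cube (c ^ (x / 3))) ⟩
  c ^ (x % 3) * cube (c ^ (x / 3))   ∎
  where
  open ≡-Reasoning
  ^3≡cube : ∀ y → y * (y * (y * 1)) ≡ y * y * y
  ^3≡cube = solve-∀

remQuot-injective : ∀ {m} n {i j : Fin (m * n)} → remQuot {m} n i ≡ remQuot n j → i ≡ j
remQuot-injective {m} n {i} {j} e =
  trans (sym (combine-remQuot {m} n i)) (trans (cong (uncurry combine) e) (combine-remQuot {m} n j))

×-injective⇒≤ : ∀ {a b c d} (f : Fin a × Fin b → Fin c × Fin d) →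
                (∀ {x y} → f x ≡ f y → x ≡ y) → a * b ≤ c * d
×-injective⇒≤ {a} {b} f f-injective = injective⇒≤ {f = uncurry combine ∘ f ∘ remQuot {a} b} λ {x} {y} e →
  let (e₁ , e₂) = combine-injective (proj₁ (f (remQuot {a} b x))) (proj₂ (f (remQuot {a} b x)))
                                    (proj₁ (f (remQuot {a} b y))) (proj₂ (f (remQuot {a} b y))) e
  in remQuot-injective {a} b (f-injective (cong₂ _,_ e₁ e₂))

lookup-injective : ∀ {a} {A : Set a} {xs : List A} → Unique xs → ∀ i j → lookup xs i ≡ lookup xs j → i ≡ j
lookup-injective (_  ∷ _) zero    zero    _ = refl
lookup-injective (x∉ ∷ _) zero    (suc j) e = contradiction e (All.lookup x∉ (∈-lookup j))
lookup-injective (x∉ ∷ _) (suc i) zero    e = contradiction (sym e) (All.lookup x∉ (∈-lookup i))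
lookup-injective (_  ∷ u) (suc i) (suc j) e = cong suc (lookup-injective u i j e)

+-<-halves : ∀ {m n p} → 2 * m < p → 2 * n < p → m + n < p
+-<-halves {m} {n} {p} 2m<p 2n<p = *-cancelˡ-< 2 (m + n) p (begin-strict
  2 * (m + n)    ≡⟨ *-distribˡ-+ 2 m n ⟩
  2 * m + 2 * n  <⟨ +-mono-< 2m<p 2n<p ⟩
  p + p          ≡⟨ cong (p +_) (+-identityʳ p) ⟨
  2 * p          ∎)
  where open ≤-Reasoning

complement<half : ∀ {p r} → p % 2 ≡ 1 → r < p → p ≤ 2 * r → 2 * (p ∸ r) < p
complement<half {p} {r} p-odd r<p p≤2r = begin-strict
  2 * s      ≡⟨ cong (s +_) (+-identityʳ s) ⟩
  s + s      <⟨ +-monoʳ-< s s<r ⟩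
  s + r      ≡⟨ +-comm s r ⟩
  r + s      ≡⟨ m+[n∸m]≡n (<⇒≤ r<p) ⟩
  p          ∎
  where
  open ≤-Reasoning
  s = p ∸ r
  p≢2r : p ≢ 2 * r
  p≢2r p≡2r = 1≢0 (trans (sym p-odd) (trans (cong (_% 2) (trans p≡2r (*-comm 2 r))) (m*n%n≡0 r 2)))
    where 1≢0 : 1 ≢ 0
          1≢0 ()
  s<r : s < r
  s<r = +-cancelˡ-< r s r (begin-strict
    r + s      ≡⟨ m+[n∸m]≡n (<⇒≤ r<p) ⟩
    p          <⟨ ≤∧≢⇒< p≤2r p≢2r ⟩
    2 * r      ≡⟨ cong (r +_) (+-identityʳ r) ⟩
    r + r      ∎)

3[1+q]<9q : ∀ {q} → 1 ≤ q → 3 * suc q < 3 * 3 * q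
3[1+q]<9q {suc r} _ = subst (3 * suc (suc r) <_) (sym (split r)) (m<m+n (3 * suc (suc r)) {3 + 6 * r} (s≤s z≤n))
  where
  split : ∀ r → 3 * 3 * suc r ≡ 3 * suc (suc r) + (3 + 6 * r)
  split = solve-∀

%6≡1⇒odd : ∀ {p} → p % 6 ≡ 1 → p % 2 ≡ 1
%6≡1⇒odd {p} p%6≡1 = trans (sym (m∣n⇒o%n%m≡o%m 2 6 p (divides 3 refl))) (cong (_% 2) p%6≡1)

%6≡1⇒7≤ : ∀ {p} → 1 < p → p % 6 ≡ 1 → 7 ≤ p
%6≡1⇒7≤ {p} 1<p p%6≡1 with p / 6 | m≡m%n+[m/n]*n p 6
... | zero  | p≡ = contradiction (trans p≡ (cong (_+ 0) p%6≡1)) (>⇒≢ 1<p)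
... | suc k | p≡ = subst (7 ≤_) (sym (trans p≡ (cong (_+ suc k * 6) p%6≡1))) (s≤s (s≤s (s≤s (s≤s (s≤s (s≤s (s≤s z≤n)))))))

module Congruence (n : ℕ) .{{_ : NonZero n}} where

  -- A record rather than a % n ≡ b % n, so that a and b can be inferred from a proof.
  infix 4 _≈_
  record _≈_ (a b : ℕ) : Set where
    constructor mk
    field %≡% : a % n ≡ b % n
  open _≈_ public

  ≈-setoid : Setoid 0ℓ 0ℓ
  ≈-setoid = record
    { _≈_ = _≈_
    ; isEquivalence = record
      { refl = mk refl
      ; sym = λ (mk e) → mk (sym e)
      ; trans = λ (mk e) (mk f) → mk (trans e f)
      }
    }

  open Setoid ≈-setoid public using () renaming (refl to ≈-refl; sym to ≈-sym; trans to ≈-trans)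
  open import Relation.Binary.Reasoning.Setoid ≈-setoid public

  ≡⇒≈ : ∀ {a b} → a ≡ b → a ≈ b
  ≡⇒≈ refl = ≈-refl

  %-≈ : ∀ a → a % n ≈ a
  %-≈ a = mk (m%n%n≡m%n a n)

  *n≈0 : ∀ k → k * n ≈ 0
  *n≈0 k = mk (trans (m*n%n≡0 k n) (sym (m*n%n≡0 0 n)))

  modulus≈0 : n ≈ 0
  modulus≈0 = mk (trans (n%n≡0 n) (sym (m*n%n≡0 0 n)))

  infix 4 _≈?_
  _≈?_ : ∀ a b → Dec (a ≈ b)
  a ≈? b = map′ mk %≡% (a % n ≟ b % n)

  <n⇒≈⇒≡ : ∀ {a b} → a < n → b < n → a ≈ b → a ≡ b
  <n⇒≈⇒≡ a<n b<n (mk e) = trans (sym (m<n⇒m%n≡m a<n)) (trans e (m<n⇒m%n≡m b<n))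

  +-cong : ∀ {a a′ b b′} → a ≈ a′ → b ≈ b′ → a + b ≈ a′ + b′
  +-cong {a} {a′} {b} {b′} (mk e) (mk f) = mk (trans (%-distribˡ-+ a b n)
    (trans (cong₂ (λ x y → (x + y) % n) e f) (sym (%-distribˡ-+ a′ b′ n))))

  *-cong : ∀ {a a′ b b′} → a ≈ a′ → b ≈ b′ → a * b ≈ a′ * b′
  *-cong {a} {a′} {b} {b′} (mk e) (mk f) = mk (trans (%-distribˡ-* a b n)
    (trans (cong₂ (λ x y → (x * y) % n) e f) (sym (%-distribˡ-* a′ b′ n))))

  +-congˡ : ∀ c {a b} → a ≈ b → c + a ≈ c + b
  +-congˡ c = +-cong (≈-refl {c})
  +-congʳ : ∀ c {a b} → a ≈ b → a + c ≈ b + c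
  +-congʳ c e = +-cong e (≈-refl {c})
  *-congˡ : ∀ c {a b} → a ≈ b → c * a ≈ c * b
  *-congˡ c = *-cong (≈-refl {c})
  *-congʳ : ∀ c {a b} → a ≈ b → a * c ≈ b * c
  *-congʳ c e = *-cong e (≈-refl {c})

  infix 8 -_
  -_ : ℕ → ℕ
  - a = pred n * a

  +-inverseʳ : ∀ a → a + - a ≈ 0
  +-inverseʳ a = begin
    a + pred n * a  ≡⟨ cong (_* a) (suc-pred n) ⟩
    n * a           ≡⟨ *-comm n a ⟩
    a * n           ≈⟨ *n≈0 a ⟩
    0               ∎

  +-cancelˡ : ∀ a {x y} → a + x ≈ a + y → x ≈ y
  +-cancelˡ a {x} {y} e = begin
    x               ≈⟨ +-congʳ x (+-inverseʳ a) ⟨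
    a + - a + x     ≡⟨ cong (_+ x) (+-comm a (- a)) ⟩
    - a + a + x     ≡⟨ +-assoc (- a) a x ⟩
    - a + (a + x)   ≈⟨ +-congˡ (- a) e ⟩
    - a + (a + y)   ≡⟨ +-assoc (- a) a y ⟨
    - a + a + y     ≡⟨ cong (_+ y) (+-comm (- a) a) ⟩
    a + - a + y     ≈⟨ +-congʳ y (+-inverseʳ a) ⟩
    y               ∎

  +-cancelʳ : ∀ a {x y} → x + a ≈ y + a → x ≈ y
  +-cancelʳ a {x} {y} e = +-cancelˡ a (begin
    a + x  ≡⟨ +-comm a x ⟩
    x + a  ≈⟨ e ⟩
    y + a  ≡⟨ +-comm y a ⟩
    a + y  ∎)

  +-round-trip : ∀ x {y a b} → x + a ≈ y → y + b ≈ x → a + b ≈ 0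
  +-round-trip x {y} {a} {b} e e′ = +-cancelˡ x (begin
    x + (a + b)  ≡⟨ +-assoc x a b ⟨
    x + a + b    ≈⟨ +-congʳ b e ⟩
    y + b        ≈⟨ e′ ⟩
    x            ≡⟨ +-identityʳ x ⟨
    x + 0        ∎)

  neg-unique : ∀ {a b} → a + b ≈ 0 → b ≈ - a
  neg-unique {a} {b} e = +-cancelˡ a (≈-trans e (≈-sym (+-inverseʳ a)))

  -1*-1≈1 : - 1 * - 1 ≈ 1
  -1*-1≈1 = +-cancelʳ (- 1) (begin
    - 1 * - 1 + - 1      ≡⟨ +-comm (- 1 * - 1) (- 1) ⟩
    - 1 + - 1 * - 1      ≡⟨ cong (_+ - 1 * - 1) (*-identityˡ (- 1)) ⟨
    1 * - 1 + - 1 * - 1  ≡⟨ *-distribʳ-+ (- 1) 1 (- 1) ⟨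
    (1 + - 1) * - 1      ≈⟨ *-congʳ (- 1) (+-inverseʳ 1) ⟩
    0                    ≈⟨ +-inverseʳ 1 ⟨
    1 + - 1              ∎)


module PrimeResidues (p : ℕ) .{{_ : NonZero p}} (p-prime : Prime p) where

  open Congruence p public

  1<p : 1 < p
  1<p = nonTrivial⇒n>1 p {{prime⇒nonTrivial p-prime}}

  Unit : ℕ → Set
  Unit a = ¬ a ≈ 0

  Unit? : ∀ a → Dec (Unit a)
  Unit? a = ¬? (a ≈? 0)

  ≈0⇒∣ : ∀ {a} → a ≈ 0 → p ∣ a
  ≈0⇒∣ {a} (mk e) = m%n≡0⇒n∣m a p (trans e (m*n%n≡0 0 p))

  ∣⇒≈0 : ∀ {a} → p ∣ a → a ≈ 0
  ∣⇒≈0 {a} d = mk (trans (n∣m⇒m%n≡0 a p d) (sym (m*n%n≡0 0 p)))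

  Unit-resp : ∀ {a b} → a ≈ b → Unit a → Unit b
  Unit-resp a≈b ua b≈0 = ua (≈-trans a≈b b≈0)

  Unit-* : ∀ {a b} → Unit a → Unit b → Unit (a * b)
  Unit-* {a} {b} ua ub ab≈0 = [ ua ∘ ∣⇒≈0 , ub ∘ ∣⇒≈0 ]′ (euclidsLemma a b p-prime (≈0⇒∣ ab≈0))

  0<a<p⇒Unit : ∀ {a} → 0 < a → a < p → Unit a
  0<a<p⇒Unit {a} 0<a a<p a≈0 = <⇒≢ 0<a (sym (<n⇒≈⇒≡ a<p (<-trans 0<a a<p) a≈0))

  Unit-1 : Unit 1
  Unit-1 = 0<a<p⇒Unit (s≤s z≤n) 1<p

  *≈1⇒Unitʳ : ∀ {a b} → a * b ≈ 1 → Unit b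
  *≈1⇒Unitʳ {a} {b} ab≈1 b≈0 = Unit-1 (begin
    1      ≈⟨ ab≈1 ⟨
    a * b  ≈⟨ *-congˡ a b≈0 ⟩
    a * 0  ≡⟨ *-zeroʳ a ⟩
    0      ∎)

  inverse-exists : ∀ {a} → Unit a → ∃ λ b → a * b ≈ 1
  inverse-exists {a} ua with coprime-Bézout (prime⇒coprime p-prime (m%n<n a p))
    where instance _ : NonZero (a % p)
                   _ = ≢-nonZero (λ e → ua (mk (trans e (sym (m*n%n≡0 0 p)))))
  ... | Bézout.-+ x y eq = y , (begin
    a * y            ≈⟨ *-congʳ y (%-≈ a) ⟨
    a % p * y        ≡⟨ *-comm (a % p) y ⟩
    y * (a % p)      ≡⟨ eq ⟨
    1 + x * p        ≈⟨ +-congˡ 1 (*n≈0 x) ⟩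
    1 + 0            ≡⟨⟩
    1                ∎)
  ... | Bézout.+- x y eq = - y , (begin
    a * - y          ≡⟨ rearrange a y (pred p) ⟩
    - 1 * (y * a)    ≈⟨ *-congˡ (- 1) (neg-unique ya+1≈0) ⟩
    - 1 * - 1        ≈⟨ -1*-1≈1 ⟩
    1                ∎)
    where
    rearrange : ∀ a y m → a * (m * y) ≡ m * 1 * (y * a)
    rearrange = solve-∀
    ya+1≈0 : 1 + y * a ≈ 0
    ya+1≈0 = begin
      1 + y * a          ≈⟨ +-congˡ 1 (*-congˡ y (%-≈ a)) ⟨
      1 + y * (a % p)    ≡⟨ eq ⟩
      x * p              ≈⟨ *n≈0 x ⟩
      0                  ∎

  residue : ℕ → Fin p
  residue a = fromℕ< (m%n<n a p)

  toℕ-residue : ∀ a → toℕ (residue a) ≈ a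
  toℕ-residue a = ≈-trans (≡⇒≈ (toℕ-fromℕ< (m%n<n a p))) (%-≈ a)

  -- Exhaustive search among 0, …, p-1; the junk value 0 is returned when nothing is found.
  abstract
    solution : (P : ℕ → Set) → (∀ x → Dec (P x)) → ℕ
    solution P P? with any? (λ (x : Fin p) → P? (toℕ x))
    ... | yes (x , _) = toℕ x
    ... | no _        = 0

    solution-correct : ∀ (P : ℕ → Set) (P? : ∀ x → Dec (P x)) →
                       (∀ {a b} → a ≈ b → P a → P b) → ∀ a → P a → P (solution P P?)
    solution-correct P P? P-resp a Pa with any? (λ (x : Fin p) → P? (toℕ x))
    ... | yes (_ , Px) = Px
    ... | no none      = contradiction (residue a , P-resp (≈-sym (toℕ-residue a)) Pa) none

  inv : ℕ → ℕ
  inv a = solution (λ x → a * x ≈ 1) (λ x → a * x ≈? 1)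

  *-inverseʳ : ∀ {a} → Unit a → a * inv a ≈ 1
  *-inverseʳ {a} ua = uncurry (solution-correct (λ x → a * x ≈ 1) (λ x → a * x ≈? 1)
    (λ x≈y e → ≈-trans (*-congˡ a (≈-sym x≈y)) e)) (inverse-exists ua)

  *-inverseˡ : ∀ {a} → Unit a → inv a * a ≈ 1
  *-inverseˡ {a} ua = ≈-trans (≡⇒≈ (*-comm (inv a) a)) (*-inverseʳ ua)

  Unit-inv : ∀ {a} → Unit a → Unit (inv a)
  Unit-inv {a} ua = *≈1⇒Unitʳ {a} (*-inverseʳ ua)

  *-cancelˡ : ∀ {c x y} → Unit c → c * x ≈ c * y → x ≈ y
  *-cancelˡ {c} {x} {y} uc e = begin
    x                ≡⟨ *-identityˡ x ⟨
    1 * x            ≈⟨ *-congʳ x (*-inverseˡ uc) ⟨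
    inv c * c * x    ≡⟨ *-assoc (inv c) c x ⟩
    inv c * (c * x)  ≈⟨ *-congˡ (inv c) e ⟩
    inv c * (c * y)  ≡⟨ *-assoc (inv c) c y ⟨
    inv c * c * y    ≈⟨ *-congʳ y (*-inverseˡ uc) ⟩
    1 * y            ≡⟨ *-identityˡ y ⟩
    y                ∎

  cube-cong : ∀ {a b} → a ≈ b → cube a ≈ cube b
  cube-cong e = *-cong (*-cong e e) e

  Unit-^ : ∀ {c} → Unit c → ∀ n → Unit (c ^ n)
  Unit-^ uc zero    = Unit-1
  Unit-^ uc (suc n) = Unit-* uc (Unit-^ uc n)

  Unit-cube : ∀ {x} → Unit x → Unit (cube x)
  Unit-cube ux = Unit-* (Unit-* ux ux) ux

  Unit-cube⁻¹ : ∀ {x} → Unit (cube x) → Unit x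
  Unit-cube⁻¹ {x} ux³ x≈0 = ux³ (cube-cong x≈0)

  IsCube : ℕ → Set
  IsCube a = ∃ λ x → Unit x × cube x ≈ a

  IsCube? : ∀ a → Dec (IsCube a)
  IsCube? a = map′
    (λ (x , ux , e) → toℕ x , ux , e)
    (λ (x , ux , e) → residue x , Unit-resp (≈-sym (toℕ-residue x)) ux ,
                      ≈-trans (cube-cong (toℕ-residue x)) e)
    (any? λ (x : Fin p) → Unit? (toℕ x) ×-dec (cube (toℕ x) ≈? a))

  IsCube-resp : ∀ {a b} → a ≈ b → IsCube a → IsCube b
  IsCube-resp a≈b (x , ux , e) = x , ux , ≈-trans e a≈b

  IsCube-≡ : ∀ {a b} → a ≡ b → IsCube a → IsCube b
  IsCube-≡ = IsCube-resp ∘ ≡⇒≈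

  IsCube-cube : ∀ {x} → Unit x → IsCube (cube x)
  IsCube-cube {x} ux = x , ux , ≈-refl

  IsCube⇒Unit : ∀ {a} → IsCube a → Unit a
  IsCube⇒Unit (x , ux , e) = Unit-resp e (Unit-cube ux)

  IsCube-* : ∀ {a b} → IsCube a → IsCube b → IsCube (a * b)
  IsCube-* (x , ux , ex) (y , uy , ey) = x * y , Unit-* ux uy , ≈-trans (≡⇒≈ (cube-* x y)) (*-cong ex ey)

  IsCube-/ : ∀ {a b} → IsCube (a * b) → IsCube b → IsCube a
  IsCube-/ {a} {b} (x , ux , ex) (y , uy , ey) = x * inv y , Unit-* ux (Unit-inv uy) , (begin
    cube (x * inv y)              ≡⟨ cube-* x (inv y) ⟩
    cube x * cube (inv y)         ≈⟨ *-congʳ (cube (inv y)) (≈-trans ex (*-congˡ a (≈-sym ey))) ⟩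
    a * cube y * cube (inv y)     ≡⟨ *-assoc a (cube y) (cube (inv y)) ⟩
    a * (cube y * cube (inv y))   ≡⟨ cong (a *_) (cube-* y (inv y)) ⟨
    a * cube (y * inv y)          ≈⟨ *-congˡ a (cube-cong (*-inverseʳ uy)) ⟩
    a * 1                         ≡⟨ *-identityʳ a ⟩
    a                             ∎)

  IsCube-neg : ∀ {a} → IsCube a → IsCube (- a)
  IsCube-neg {a} = IsCube-≡ (cong (_* a) (*-identityʳ (pred p))) ∘ IsCube-* IsCube-[-1]
    where
    IsCube-[-1] : IsCube (- 1)
    IsCube-[-1] = - 1 , *≈1⇒Unitʳ { - 1} -1*-1≈1 , ≈-trans (*-congʳ (- 1) -1*-1≈1) (≡⇒≈ (*-identityˡ (- 1)))

  ¬IsCube-square : ∀ {a} → ¬ IsCube a → ¬ IsCube (a * a)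
  ¬IsCube-square {a} ¬a a² = ¬a (IsCube-/ (IsCube-≡ (*-assoc a a a) (IsCube-cube ua)) a²)
    where ua : Unit a
          ua a≈0 = IsCube⇒Unit a² (*-cong a≈0 a≈0)

  IsCube-1 : IsCube 1
  IsCube-1 = IsCube-cube Unit-1

  IsCube-inv : ∀ {a} → IsCube a → IsCube (inv a)
  IsCube-inv {a} ca = IsCube-/ (IsCube-resp (≈-sym (*-inverseˡ (IsCube⇒Unit ca))) IsCube-1) ca

  IsCube⇒IsUnitCube : ∀ {a} → IsCube a → IsUnitCube p a
  IsCube⇒IsUnitCube (x , ux , mk e) = x , (λ x%p≡0 → ux (mk (trans x%p≡0 (sym (m*n%n≡0 0 p))))) , e

  ≡-¬IsCube : ∀ {x y} → x ≡ y → ¬ IsCube y → ¬ IsCube x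
  ≡-¬IsCube x≡y ¬y = ¬y ∘ IsCube-≡ x≡y

  cube≈1⇒ : ∀ {k} → cube k ≈ 1 → k ≈ 1 ⊎ k * k + k + 1 ≈ 0
  cube≈1⇒ {k} k³≈1 with k * k + k + 1 ≈? 0
  ... | yes e = inj₂ e
  ... | no u  = inj₁ (*-cancelˡ u (begin
    (k * k + k + 1) * k   ≡⟨ expandˡ k ⟩
    cube k + (k * k + k)  ≈⟨ +-congʳ (k * k + k) k³≈1 ⟩
    1 + (k * k + k)       ≡⟨ expandʳ k ⟩
    (k * k + k + 1) * 1   ∎))
    where
    expandˡ : ∀ k → (k * k + k + 1) * k ≡ k * k * k + (k * k + k)
    expandˡ = solve-∀
    expandʳ : ∀ k → 1 + (k * k + k) ≡ (k * k + k + 1) * 1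
    expandʳ = solve-∀

  roots-of-x²+x+1 : ∀ {u v} → u * u + u + 1 ≈ 0 → v * v + v + 1 ≈ 0 → u ≈ v ⊎ u + v + 1 ≈ 0
  roots-of-x²+x+1 {u} {v} eu ev with u + v + 1 ≈? 0
  ... | yes e = inj₂ e
  ... | no w  = inj₁ (*-cancelˡ w (begin
    (u + v + 1) * u      ≡⟨ expand u v ⟩
    u * u + u + u * v    ≈⟨ +-congʳ (u * v) (+-cancelʳ 1 (≈-trans eu (≈-sym ev))) ⟩
    v * v + v + u * v    ≡⟨ trans (cong (v * v + v +_) (*-comm u v)) (sym (expand v u)) ⟩
    (v + u + 1) * v      ≡⟨ cong (λ z → (z + 1) * v) (+-comm v u) ⟩
    (u + v + 1) * v      ∎))
    where
    expand : ∀ u v → (u + v + 1) * u ≡ u * u + u + u * v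
    expand = solve-∀

  ω : ℕ
  ω = solution (λ x → x * x + x + 1 ≈ 0) (λ x → x * x + x + 1 ≈? 0)

  ω-root : ∀ k → k * k + k + 1 ≈ 0 → ω * ω + ω + 1 ≈ 0
  ω-root = solution-correct (λ x → x * x + x + 1 ≈ 0) (λ x → x * x + x + 1 ≈? 0)
    (λ x≈y e → ≈-trans (≈-sym (+-congʳ 1 (+-cong (*-cong x≈y x≈y) x≈y))) e)

  third-cube-root : ∀ {k} → cube k ≈ 1 → ¬ k ≈ 1 → ¬ k ≈ ω → k + ω + 1 ≈ 0
  third-cube-root {k} k³≈1 k≉1 k≉ω with cube≈1⇒ k³≈1
  ... | inj₁ k≈1 = contradiction k≈1 k≉1
  ... | inj₂ r with roots-of-x²+x+1 {k} {ω} r (ω-root k r)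
  ...   | inj₁ k≈ω = contradiction k≈ω k≉ω
  ...   | inj₂ s   = s

  cubeRootOfUnityIndex : ℕ → Fin 3
  cubeRootOfUnityIndex k with k ≈? 1 | k ≈? ω
  ... | yes _ | _     = 0F
  ... | no _  | yes _ = 1F
  ... | no _  | no _  = 2F

  cubeRootOfUnityIndex-injective : ∀ {k k′} → cube k ≈ 1 → cube k′ ≈ 1 →
    cubeRootOfUnityIndex k ≡ cubeRootOfUnityIndex k′ → k ≈ k′
  cubeRootOfUnityIndex-injective {k} {k′} k³≈1 k′³≈1 same
    with k ≈? 1 | k ≈? ω | k′ ≈? 1 | k′ ≈? ω | same
  ... | yes k≈1 | _       | yes k′≈1 | _        | _ = ≈-trans k≈1 (≈-sym k′≈1)
  ... | no _    | yes k≈ω | no _     | yes k′≈ω | _ = ≈-trans k≈ω (≈-sym k′≈ω)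
  ... | no k≉1  | no k≉ω  | no k′≉1  | no k′≉ω  | _ = +-cancelʳ ω (+-cancelʳ 1 (≈-trans
        (third-cube-root k³≈1 k≉1 k≉ω) (≈-sym (third-cube-root k′³≈1 k′≉1 k′≉ω))))
  ... | yes _   | _       | no _     | yes _    | ()
  ... | yes _   | _       | no _     | no _     | ()
  ... | no _    | yes _   | yes _    | _        | ()
  ... | no _    | yes _   | no _     | no _     | ()
  ... | no _    | no _    | yes _    | _        | ()
  ... | no _    | no _    | no _     | yes _    | ()

  cubeRoot : ℕ → ℕ
  cubeRoot t = solution (λ x → cube x ≈ t) (λ x → cube x ≈? t)

  -- The root is taken of the residue of g³, so that it only depends on g³ modulo p.
  canonicalRoot : ℕ → ℕ
  canonicalRoot g = cubeRoot (cube g % p)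

  canonicalRoot-cube : ∀ g → cube (canonicalRoot g) ≈ cube g
  canonicalRoot-cube g = ≈-trans
    (solution-correct (λ x → cube x ≈ cube g % p) (λ x → cube x ≈? cube g % p)
      (λ x≈y e → ≈-trans (≈-sym (cube-cong x≈y)) e) g (≈-sym (%-≈ (cube g))))
    (%-≈ (cube g))

  cube-÷-root≈1 : ∀ {r} → Unit r → ∀ g → cube r ≈ cube g → cube (g * inv r) ≈ 1
  cube-÷-root≈1 {r} ur g r³≈g³ = begin
    cube (g * inv r)         ≡⟨ cube-* g (inv r) ⟩
    cube g * cube (inv r)    ≈⟨ *-congʳ (cube (inv r)) r³≈g³ ⟨
    cube r * cube (inv r)    ≡⟨ cube-* r (inv r) ⟨
    cube (r * inv r)         ≈⟨ cube-cong (*-inverseʳ ur) ⟩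
    1                        ∎

  *-inv-*-cancel : ∀ {r} → Unit r → ∀ h → h * inv r * r ≈ h
  *-inv-*-cancel {r} ur h = begin
    h * inv r * r    ≡⟨ *-assoc h (inv r) r ⟩
    h * (inv r * r)  ≈⟨ *-congˡ h (*-inverseˡ ur) ⟩
    h * 1            ≡⟨ *-identityʳ h ⟩
    h                ∎

  -- g is the canonical root of g³ times a cube root of unity, which is labelled by Fin 3.
  cubeFibreIndex : ℕ → Fin 3
  cubeFibreIndex g = cubeRootOfUnityIndex (g * inv (canonicalRoot g))

  cubeFibreIndex-injective : ∀ {g g′} → Unit g → cube g ≈ cube g′ →
                             cubeFibreIndex g ≡ cubeFibreIndex g′ → g ≈ g′
  cubeFibreIndex-injective {g} {g′} ug g³≈g′³ same = begin
    g                 ≈⟨ *-inv-*-cancel ur g ⟨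
    g * inv r * r     ≈⟨ *-congʳ r unity-parts-equal ⟩
    g′ * inv r * r    ≈⟨ *-inv-*-cancel ur g′ ⟩
    g′                ∎
    where
    r = canonicalRoot g
    ur : Unit r
    ur = Unit-cube⁻¹ (Unit-resp (≈-sym (canonicalRoot-cube g)) (Unit-cube ug))
    same-root : canonicalRoot g′ ≡ r
    same-root = cong cubeRoot (sym (%≡% g³≈g′³))
    unity-parts-equal : g * inv r ≈ g′ * inv r
    unity-parts-equal = cubeRootOfUnityIndex-injective
      (cube-÷-root≈1 ur g (canonicalRoot-cube g))
      (cube-÷-root≈1 ur g′ (≈-trans (canonicalRoot-cube g) g³≈g′³))
      (subst (λ s → cubeRootOfUnityIndex (g * inv r) ≡ cubeRootOfUnityIndex (g′ * inv s)) same-root same)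

  -- If a, b, ab and ab² were all non-cubes, the nine classes aⁱbʲC of the cubes C would be
  -- distinct; each class has at least (p - 1)/3 elements, since x ↦ x³ is at most 3-to-1.
  module IndependentNoncubes {a b : ℕ} (ua : Unit a) (ub : Unit b) (¬a : ¬ IsCube a)
    (¬b : ¬ IsCube b) (¬ab : ¬ IsCube (a * b)) (¬ab² : ¬ IsCube (a * (b * b))) where

    monomial : ℕ → ℕ → ℕ
    monomial x y = a ^ x * b ^ y

    Unit-monomial : ∀ x y → Unit (monomial x y)
    Unit-monomial x y = Unit-* (Unit-^ ua x) (Unit-^ ub y)

    monomial-+ : ∀ x y x′ y′ → monomial x y * monomial x′ y′ ≡ monomial (x + x′) (y + y′)
    monomial-+ x y x′ y′ = trans (*-interchange (a ^ x) (b ^ y) (a ^ x′) (b ^ y′))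
      (sym (cong₂ _*_ (^-distribˡ-+-* a x x′) (^-distribˡ-+-* b y y′)))

    monomial-mod-3 : ∀ x y → monomial x y ≡ monomial (x % 3) (y % 3) * cube (a ^ (x / 3) * b ^ (y / 3))
    monomial-mod-3 x y = trans (cong₂ _*_ (^-split-mod-3 a x) (^-split-mod-3 b y))
      (trans (*-interchange (a ^ (x % 3)) (cube (a ^ (x / 3))) (b ^ (y % 3)) (cube (b ^ (y / 3))))
             (cong (monomial (x % 3) (y % 3) *_) (sym (cube-* (a ^ (x / 3)) (b ^ (y / 3))))))

    ¬a²b : ¬ IsCube (a * a * b)
    ¬a²b a²b = ¬ab² (IsCube-/ (IsCube-≡ (square a b) (IsCube-* a²b a²b)) (IsCube-cube ua))
      where
      square : ∀ a b → a * a * b * (a * a * b) ≡ a * (b * b) * (a * a * a)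
      square = solve-∀

    IsCube-monomial< : ∀ x y → x < 3 → y < 3 → IsCube (monomial x y) → x ≡ 0 × y ≡ 0
    IsCube-monomial< 0 0 _ _ _ = refl , refl
    IsCube-monomial< 0 1 _ _ c = contradiction c (≡-¬IsCube (trans (*-identityˡ (b ^ 1)) (^1 b)) ¬b)
    IsCube-monomial< 0 2 _ _ c = contradiction c (≡-¬IsCube (trans (*-identityˡ (b ^ 2)) (^2 b)) (¬IsCube-square ¬b))
    IsCube-monomial< 1 0 _ _ c = contradiction c (≡-¬IsCube (trans (*-identityʳ (a ^ 1)) (^1 a)) ¬a)
    IsCube-monomial< 1 1 _ _ c = contradiction c (≡-¬IsCube (cong₂ _*_ (^1 a) (^1 b)) ¬ab)
    IsCube-monomial< 1 2 _ _ c = contradiction c (≡-¬IsCube (cong₂ _*_ (^1 a) (^2 b)) ¬ab²)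
    IsCube-monomial< 2 0 _ _ c = contradiction c (≡-¬IsCube (trans (*-identityʳ (a ^ 2)) (^2 a)) (¬IsCube-square ¬a))
    IsCube-monomial< 2 1 _ _ c = contradiction c (≡-¬IsCube (cong₂ _*_ (^2 a) (^1 b)) ¬a²b)
    IsCube-monomial< 2 2 _ _ c = contradiction c
      (≡-¬IsCube (trans (cong₂ _*_ (^2 a) (^2 b)) (*-interchange a a b b)) (¬IsCube-square ¬ab))
    IsCube-monomial< (suc (suc (suc _))) _ (s≤s (s≤s (s≤s ()))) _
    IsCube-monomial< _ (suc (suc (suc _))) _ (s≤s (s≤s (s≤s ())))

    IsCube-monomial : ∀ x y → IsCube (monomial x y) → x % 3 ≡ 0 × y % 3 ≡ 0
    IsCube-monomial x y c = IsCube-monomial< (x % 3) (y % 3) (m%n<n x 3) (m%n<n y 3)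
      (IsCube-/ (IsCube-≡ (monomial-mod-3 x y) c)
                (IsCube-cube (Unit-* (Unit-^ ua (x / 3)) (Unit-^ ub (y / 3)))))

    [i+2j]%3≡0⇒i≡j : ∀ (i j : Fin 3) → (toℕ i + (toℕ j + toℕ j)) % 3 ≡ 0 → i ≡ j
    [i+2j]%3≡0⇒i≡j 0F 0F _ = refl
    [i+2j]%3≡0⇒i≡j 1F 1F _ = refl
    [i+2j]%3≡0⇒i≡j 2F 2F _ = refl
    [i+2j]%3≡0⇒i≡j 0F 1F ()
    [i+2j]%3≡0⇒i≡j 0F 2F ()
    [i+2j]%3≡0⇒i≡j 1F 0F ()
    [i+2j]%3≡0⇒i≡j 1F 2F ()
    [i+2j]%3≡0⇒i≡j 2F 0F ()
    [i+2j]%3≡0⇒i≡j 2F 1F ()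

    class : Fin 3 × Fin 3 → ℕ
    class (i , j) = monomial (toℕ i) (toℕ j)

    class-injective : ∀ {G G′} ij ij′ → IsCube G → IsCube G′ → class ij * G ≈ class ij′ * G′ → ij ≡ ij′
    class-injective {G} {G′} (i , j) (i′ , j′) cG cG′ e =
      cong₂ _,_ ([i+2j]%3≡0⇒i≡j i i′ (proj₁ exponents)) ([i+2j]%3≡0⇒i≡j j j′ (proj₂ exponents))
      where
      c = class (i , j)
      d = class (i′ , j′)
      cd²G : IsCube (c * (d * d) * G)
      cd²G = IsCube-resp (≈-sym (begin
        c * (d * d) * G  ≡⟨ rearrange c d G ⟩
        c * G * (d * d)  ≈⟨ *-congʳ (d * d) e ⟩
        d * G′ * (d * d) ≡⟨ rearrange′ d G′ ⟩
        cube d * G′      ∎)) (IsCube-* (IsCube-cube (Unit-monomial (toℕ i′) (toℕ j′))) cG′)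
        where
        rearrange : ∀ c d G → c * (d * d) * G ≡ c * G * (d * d)
        rearrange = solve-∀
        rearrange′ : ∀ d G → d * G * (d * d) ≡ d * d * d * G
        rearrange′ = solve-∀
      x = toℕ i + (toℕ i′ + toℕ i′)
      y = toℕ j + (toℕ j′ + toℕ j′)
      exponents : x % 3 ≡ 0 × y % 3 ≡ 0
      exponents = IsCube-monomial x y (IsCube-≡
        (trans (cong (c *_) (monomial-+ (toℕ i′) (toℕ j′) (toℕ i′) (toℕ j′)))
               (monomial-+ (toℕ i) (toℕ j) (toℕ i′ + toℕ i′) (toℕ j′ + toℕ j′)))
        (IsCube-/ {c * (d * d)} cd²G cG))

    nonzero : Fin (pred p) → ℕ
    nonzero g = suc (toℕ g)

    nonzero<p : ∀ g → nonzero g < p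
    nonzero<p g = subst (nonzero g <_) (suc-pred p) (s≤s (toℕ<n g))

    Unit-nonzero : ∀ g → Unit (nonzero g)
    Unit-nonzero g = 0<a<p⇒Unit (s≤s z≤n) (nonzero<p g)

    labelledClassMember : Fin (3 * 3) × Fin (pred p) → Fin 3 × Fin p
    labelledClassMember (k , g) = cubeFibreIndex (nonzero g) , residue (class (remQuot {3} 3 k) * cube (nonzero g))

    labelledClassMember-injective : ∀ {x y} → labelledClassMember x ≡ labelledClassMember y → x ≡ y
    labelledClassMember-injective {k , g} {k′ , g′} e = cong₂ _,_ k≡k′ g≡g′
      where
      c = class (remQuot {3} 3 k)
      G = cube (nonzero g)
      G′ = cube (nonzero g′)
      cG≈c′G′ : c * G ≈ class (remQuot {3} 3 k′) * G′
      cG≈c′G′ = begin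
        c * G                                   ≈⟨ toℕ-residue (c * G) ⟨
        toℕ (residue (c * G))                   ≡⟨ cong (toℕ ∘ proj₂) e ⟩
        toℕ (residue (class (remQuot {3} 3 k′) * G′)) ≈⟨ toℕ-residue _ ⟩
        class (remQuot {3} 3 k′) * G′               ∎
      same-class : remQuot {3} 3 k ≡ remQuot {3} 3 k′
      same-class = class-injective (remQuot {3} 3 k) (remQuot {3} 3 k′)
        (IsCube-cube (Unit-nonzero g)) (IsCube-cube (Unit-nonzero g′)) cG≈c′G′
      k≡k′ : k ≡ k′
      k≡k′ = remQuot-injective {3} 3 same-class
      G≈G′ : G ≈ G′
      G≈G′ = *-cancelˡ (Unit-monomial (toℕ (proj₁ (remQuot {3} 3 k))) (toℕ (proj₂ (remQuot {3} 3 k))))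
        (≈-trans cG≈c′G′ (≡⇒≈ (cong (λ ij → class ij * G′) (sym same-class))))
      g≡g′ : g ≡ g′
      g≡g′ = toℕ-injective (suc-injective (<n⇒≈⇒≡ (nonzero<p g) (nonzero<p g′)
        (cubeFibreIndex-injective (Unit-nonzero g) G≈G′ (cong proj₁ e))))

    -- The injectivity proof is eta-expanded to avoid a very expensive conversion check.
    impossible : ⊥
    impossible = <⇒≱ 3p<9[p-1] (×-injective⇒≤ labelledClassMember (λ {x} {y} → labelledClassMember-injective {x} {y}))
      where
      3p<9[p-1] : 3 * p < 3 * 3 * pred p
      3p<9[p-1] = subst (λ m → 3 * m < 3 * 3 * pred p) (suc-pred p) (3[1+q]<9q (pred-mono-≤ 1<p))

  cubeIndex≤3 : ∀ {a b} → Unit a → Unit b → ¬ IsCube a → ¬ IsCube b → ¬ IsCube (a * b) →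
                IsCube (a * (b * b))
  cubeIndex≤3 {a} {b} ua ub ¬a ¬b ¬ab with IsCube? (a * (b * b))
  ... | yes ab² = ab²
  ... | no ¬ab² = ⊥-elim (IndependentNoncubes.impossible ua ub ¬a ¬b ¬ab ¬ab²)

  module TransversalFactorisation
    (H : ℕ → Set) (H? : ∀ a → Dec (H a))
    (H-resp : ∀ {a b} → a ≈ b → H a → H b)
    (H⇒Unit : ∀ {a} → H a → Unit a)
    (H-neg : ∀ {a} → H a → H (- a))
    (S : List ℕ) (S⇒Unit : ∀ {t} → t ∈ S → Unit t)
    (S-covers : ∀ {d} → Unit d → ∃₂ λ c t → H c × t ∈ S × c * t ≈ d)
    (S-separates : ∀ {c c′ t t′} → H c → H c′ → t ∈ S → t′ ∈ S → c * t ≈ c′ * t′ → t ≡ t′)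
    (p-odd : p % 2 ≡ 1)
    where

    dilatedCay : ℕ → Graph p
    dilatedCay m x y = ∃[ s ] (s ∈ S × (toℕ x + m * s ≈ toℕ y ⊎ toℕ y + m * s ≈ toℕ x))

    scale : ℕ → Fin p → Fin p
    scale w x = residue (w * toℕ x)

    toℕ-scale : ∀ w x → toℕ (scale w x) ≈ w * toℕ x
    toℕ-scale w x = toℕ-residue (w * toℕ x)

    scale-inverse : ∀ {a b} → a * b ≈ 1 → ∀ x → scale a (scale b x) ≡ x
    scale-inverse {a} {b} ab≈1 x = toℕ-injective (<n⇒≈⇒≡ (toℕ<n _) (toℕ<n x) (begin
      toℕ (scale a (scale b x))  ≈⟨ toℕ-scale a (scale b x) ⟩
      a * toℕ (scale b x)        ≈⟨ *-congˡ a (toℕ-scale b x) ⟩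
      a * (b * toℕ x)            ≡⟨ *-assoc a b (toℕ x) ⟨
      a * b * toℕ x              ≈⟨ *-congʳ (toℕ x) ab≈1 ⟩
      1 * toℕ x                  ≡⟨ *-identityˡ (toℕ x) ⟩
      toℕ x                      ∎))

    dilate : ∀ {w m} → w * m ≈ 1 → ∀ {x y s} → x + m * s ≈ y → w * x + s ≈ w * y
    dilate {w} {m} wm≈1 {x} {y} {s} e = begin
      w * x + s            ≡⟨ cong (w * x +_) (*-identityˡ s) ⟨
      w * x + 1 * s        ≈⟨ +-congˡ (w * x) (*-congʳ s wm≈1) ⟨
      w * x + w * m * s    ≡⟨ cong (w * x +_) (*-assoc w m s) ⟩
      w * x + w * (m * s)  ≡⟨ *-distribˡ-+ w x (m * s) ⟨
      w * (x + m * s)      ≈⟨ *-congˡ w e ⟩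
      w * y                ∎

    undilate : ∀ {w m} → m * w ≈ 1 → ∀ {x y s} → w * x + s ≈ w * y → x + m * s ≈ y
    undilate {w} {m} mw≈1 {x} {y} {s} e = begin
      x + m * s            ≡⟨ cong (_+ m * s) (*-identityˡ x) ⟨
      1 * x + m * s        ≈⟨ +-congʳ (m * s) (*-congʳ x mw≈1) ⟨
      m * w * x + m * s    ≡⟨ cong (_+ m * s) (*-assoc m w x) ⟩
      m * (w * x) + m * s  ≡⟨ *-distribˡ-+ m (w * x) s ⟨
      m * (w * x + s)      ≈⟨ *-congˡ m e ⟩
      m * (w * y)          ≡⟨ *-assoc m w y ⟨
      m * w * y            ≈⟨ *-congʳ y mw≈1 ⟩
      1 * y                ≡⟨ *-identityˡ y ⟩
      y                    ∎

    dilatedCay≅Cay : ∀ {m} → H m → dilatedCay m ≅ Cay p S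
    dilatedCay≅Cay {m} Hm =
      mk↔ₛ′ (scale w) (scale m) (scale-inverse {w} {m} wm≈1) (scale-inverse {m} {w} mw≈1) ,
      λ x y → mk⇔ (to x y) (from x y)
      where
      w = inv m
      mw≈1 : m * w ≈ 1
      mw≈1 = *-inverseʳ (H⇒Unit Hm)
      wm≈1 : w * m ≈ 1
      wm≈1 = *-inverseˡ (H⇒Unit Hm)
      to-step : ∀ x y s → toℕ x + m * s ≈ toℕ y → toℕ (scale w x) + s ≈ toℕ (scale w y)
      to-step x y s e = ≈-trans (+-congʳ s (toℕ-scale w x)) (≈-trans (dilate {w} {m} wm≈1 {toℕ x} {toℕ y} {s} e) (≈-sym (toℕ-scale w y)))
      from-step : ∀ x y s → toℕ (scale w x) + s ≈ toℕ (scale w y) → toℕ x + m * s ≈ toℕ y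
      from-step x y s e = undilate {w} {m} mw≈1 {toℕ x} {toℕ y} {s} (≈-trans (+-congʳ s (≈-sym (toℕ-scale w x))) (≈-trans e (toℕ-scale w y)))
      to : ∀ x y → dilatedCay m x y → Cay p S (scale w x) (scale w y)
      to x y (s , s∈S , inj₁ e) = s , s∈S , inj₁ (%≡% (to-step x y s e))
      to x y (s , s∈S , inj₂ e) = s , s∈S , inj₂ (%≡% (to-step y x s e))
      from : ∀ x y → Cay p S (scale w x) (scale w y) → dilatedCay m x y
      from x y (s , s∈S , inj₁ e) = s , s∈S , inj₁ (from-step x y s (mk e))
      from x y (s , s∈S , inj₂ e) = s , s∈S , inj₂ (from-step y x s (mk e))

    dilatedCay-irreflexive : ∀ {m} → H m → ∀ u → ¬ dilatedCay m u u
    dilatedCay-irreflexive Hm u (s , s∈S , e) =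
      Unit-* (H⇒Unit Hm) (S⇒Unit s∈S) (+-cancelˡ (toℕ u) (≈-trans ([ id , id ]′ e) (≡⇒≈ (sym (+-identityʳ (toℕ u))))))

    Representative : ℕ → Set
    Representative m = H m × 2 * m < p

    Representative? : ∀ m → Dec (Representative m)
    Representative? m = H? m ×-dec (2 * m <? p)

    Representative⇒<p : ∀ {m} → Representative m → m < p
    Representative⇒<p {m} (_ , 2m<p) = ≤-<-trans (m≤m+n m (m + 0)) 2m<p

    difference : Fin p → Fin p → ℕ
    difference u v = toℕ v + (p ∸ toℕ u)

    +-difference : ∀ u v → toℕ u + difference u v ≈ toℕ v
    +-difference u v = begin
      toℕ u + (toℕ v + (p ∸ toℕ u))  ≡⟨ +-assoc (toℕ u) (toℕ v) _ ⟨
      toℕ u + toℕ v + (p ∸ toℕ u)    ≡⟨ cong (_+ (p ∸ toℕ u)) (+-comm (toℕ u) (toℕ v)) ⟩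
      toℕ v + toℕ u + (p ∸ toℕ u)    ≡⟨ +-assoc (toℕ v) (toℕ u) _ ⟩
      toℕ v + (toℕ u + (p ∸ toℕ u))  ≡⟨ cong (toℕ v +_) (m+[n∸m]≡n (<⇒≤ (toℕ<n u))) ⟩
      toℕ v + p                      ≈⟨ +-congˡ (toℕ v) modulus≈0 ⟩
      toℕ v + 0                      ≡⟨ +-identityʳ (toℕ v) ⟩
      toℕ v                          ∎

    Unit-difference : ∀ {u v} → u ≢ v → Unit (difference u v)
    Unit-difference {u} {v} u≢v d≈0 = u≢v (toℕ-injective (<n⇒≈⇒≡ (toℕ<n u) (toℕ<n v) (begin
      toℕ u                     ≡⟨ +-identityʳ (toℕ u) ⟨
      toℕ u + 0                 ≈⟨ +-congˡ (toℕ u) d≈0 ⟨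
      toℕ u + difference u v    ≈⟨ +-difference u v ⟩
      toℕ v                     ∎)))

    -- Of the two elements ±c of H, the one below p/2 is a representative.
    edge-covered : ∀ u v → u ≢ v → ∃ λ m → Representative m × dilatedCay m u v
    edge-covered u v u≢v with S-covers (Unit-difference u≢v)
    ... | c , t , Hc , t∈S , ct≈d with 2 * (c % p) <? p
    ...   | yes small = c % p , (H-resp (≈-sym (%-≈ c)) Hc , small) , t , t∈S , inj₁ (begin
      toℕ u + c % p * t        ≈⟨ +-congˡ (toℕ u) (≈-trans (*-congʳ t (%-≈ c)) ct≈d) ⟩
      toℕ u + difference u v   ≈⟨ +-difference u v ⟩
      toℕ v                    ∎)
    ...   | no large = m , (H-resp (≈-sym m≈-c) (H-neg Hc) , complement<half p-odd (m%n<n c p) (≮⇒≥ large)) ,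
                       t , t∈S , inj₂ (begin
      toℕ v + m * t                       ≈⟨ +-congʳ (m * t) (+-difference u v) ⟨
      toℕ u + difference u v + m * t      ≈⟨ +-congʳ (m * t) (+-congˡ (toℕ u) ct≈d) ⟨
      toℕ u + c * t + m * t               ≡⟨ +-assoc (toℕ u) (c * t) (m * t) ⟩
      toℕ u + (c * t + m * t)             ≡⟨ cong (toℕ u +_) (*-distribʳ-+ t c m) ⟨
      toℕ u + (c + m) * t                 ≈⟨ +-congˡ (toℕ u) (*-congʳ t c+m≈0) ⟩
      toℕ u + 0                           ≡⟨ +-identityʳ (toℕ u) ⟩
      toℕ u                               ∎)
      where
      m = p ∸ c % p
      c+m≈0 : c + m ≈ 0
      c+m≈0 = begin
        c + (p ∸ c % p)        ≈⟨ +-congʳ m (%-≈ c) ⟨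
        c % p + (p ∸ c % p)    ≡⟨ m+[n∸m]≡n (<⇒≤ (m%n<n c p)) ⟩
        p                      ≈⟨ modulus≈0 ⟩
        0                      ∎
      m≈-c : m ≈ - c
      m≈-c = neg-unique c+m≈0

    coset-unique : ∀ {m m′ t t′} → H m → H m′ → t ∈ S → t′ ∈ S → m * t ≈ m′ * t′ → m ≈ m′
    coset-unique {m} {m′} {t} Hm Hm′ t∈S t′∈S e with S-separates Hm Hm′ t∈S t′∈S e
    ... | refl = *-cancelˡ (S⇒Unit t∈S) (≈-trans (≡⇒≈ (*-comm t m)) (≈-trans e (≡⇒≈ (*-comm m′ t))))

    opposite-steps-impossible : ∀ {m m′ t t′} → Representative m → Representative m′ → t ∈ S → t′ ∈ S →
                                m * t + m′ * t′ ≈ 0 → ⊥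
    opposite-steps-impossible {m} {m′} {t} {t′} (Hm , 2m<p) (Hm′ , 2m′<p) t∈S t′∈S e =
      0<a<p⇒Unit 0<m+m′ (+-<-halves {m} {m′} 2m<p 2m′<p) (begin
        m + m′        ≈⟨ +-congʳ m′ (coset-unique Hm (H-neg Hm′) t∈S t′∈S mt≈-m′t′) ⟩
        - m′ + m′     ≡⟨ +-comm (- m′) m′ ⟩
        m′ + - m′     ≈⟨ +-inverseʳ m′ ⟩
        0             ∎)
      where
      0<m+m′ : 0 < m + m′
      0<m+m′ = ≤-trans (n≢0⇒n>0 (λ m≡0 → H⇒Unit Hm (≡⇒≈ m≡0))) (m≤m+n m m′)
      mt≈-m′t′ : m * t ≈ - m′ * t′
      mt≈-m′t′ = ≈-trans (neg-unique (≈-trans (≡⇒≈ (+-comm (m′ * t′) (m * t))) e)) (≡⇒≈ (sym (*-assoc (pred p) m′ t′)))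

    edge-unique : ∀ {m m′} u v → Representative m → Representative m′ →
                  dilatedCay m u v → dilatedCay m′ u v → m ≡ m′
    edge-unique u v rep rep′ (t , t∈S , inj₁ e) (t′ , t′∈S , inj₁ e′) =
      <n⇒≈⇒≡ (Representative⇒<p rep) (Representative⇒<p rep′)
        (coset-unique (proj₁ rep) (proj₁ rep′) t∈S t′∈S (+-cancelˡ (toℕ u) (≈-trans e (≈-sym e′))))
    edge-unique u v rep rep′ (t , t∈S , inj₂ e) (t′ , t′∈S , inj₂ e′) =
      <n⇒≈⇒≡ (Representative⇒<p rep) (Representative⇒<p rep′)
        (coset-unique (proj₁ rep) (proj₁ rep′) t∈S t′∈S (+-cancelˡ (toℕ v) (≈-trans e (≈-sym e′))))
    edge-unique u v rep rep′ (t , t∈S , inj₁ e) (t′ , t′∈S , inj₂ e′) =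
      ⊥-elim (opposite-steps-impossible rep rep′ t∈S t′∈S (+-round-trip (toℕ u) e e′))
    edge-unique u v rep rep′ (t , t∈S , inj₂ e) (t′ , t′∈S , inj₁ e′) =
      ⊥-elim (opposite-steps-impossible rep rep′ t∈S t′∈S (+-round-trip (toℕ v) e e′))

    representatives : List ℕ
    representatives = filter Representative? (upTo p)

    Representative-lookup : ∀ i → Representative (lookup representatives i)
    Representative-lookup i = proj₂ (∈-filter⁻ Representative? {xs = upTo p} (∈-lookup i))

    factorisation : Factorisation p (Cay p S)
    factorisation = length representatives , dilatedCay ∘ lookup representatives ,
      (λ i → dilatedCay≅Cay (proj₁ (Representative-lookup i))) ,
      (λ i → dilatedCay-irreflexive (proj₁ (Representative-lookup i))) ,
      unique-factor
      where
      unique-factor : ∀ u v → u ≢ v → Σ (Fin (length representatives)) λ i →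
        dilatedCay (lookup representatives i) u v × (∀ j → dilatedCay (lookup representatives j) u v → j ≡ i)
      unique-factor u v u≢v with edge-covered u v u≢v
      ... | m , rep , edge = index m∈ , subst (λ n → dilatedCay n u v) m≡ edge ,
            λ j edge′ → lookup-injective (Unique.filter⁺ Representative? (Unique.upTo⁺ p)) j (index m∈)
                          (trans (edge-unique u v (Representative-lookup j) rep edge′ edge) m≡)
        where
        m∈ : m ∈ representatives
        m∈ = ∈-filter⁺ Representative? (∈-upTo⁺ (Representative⇒<p rep)) rep
        m≡ : m ≡ lookup representatives (index m∈)
        m≡ = lookup-index m∈


module CubeTransversal (p : ℕ) .{{_ : NonZero p}} (p-prime : Prime p) (p%6≡1 : p % 6 ≡ 1)
  (¬2 : ¬ IsUnitCube p 2) (¬3 : ¬ IsUnitCube p 3) (¬6 : ¬ IsUnitCube p 6) where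

  open PrimeResidues p p-prime

  noncube : ∀ {a} → ¬ IsUnitCube p a → ¬ IsCube a
  noncube ¬a = ¬a ∘ IsCube⇒IsUnitCube

  small-Unit : ∀ {a} → 0 < a → a < 7 → Unit a
  small-Unit 0<a a<7 = 0<a<p⇒Unit 0<a (<-≤-trans a<7 (%6≡1⇒7≤ 1<p p%6≡1))

  Unit-2 : Unit 2
  Unit-2 = small-Unit (s≤s z≤n) (s≤s (s≤s (s≤s z≤n)))

  Unit-3 : Unit 3
  Unit-3 = small-Unit (s≤s z≤n) (s≤s (s≤s (s≤s (s≤s z≤n))))

  Unit-4 : Unit 4
  Unit-4 = small-Unit (s≤s z≤n) (s≤s (s≤s (s≤s (s≤s (s≤s z≤n)))))

  Unit-6 : Unit 6
  Unit-6 = small-Unit (s≤s z≤n) (s≤s (s≤s (s≤s (s≤s (s≤s (s≤s (s≤s z≤n)))))))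

  -- 2 and 3 lie in the same non-trivial class, so 18 = 2·3² and 12 = 6³/18 are cubes.
  IsCube-18 : IsCube 18
  IsCube-18 = cubeIndex≤3 Unit-2 Unit-3 (noncube ¬2) (noncube ¬3) (noncube ¬6)

  IsCube-12 : IsCube 12
  IsCube-12 = IsCube-/ {12} {18} (IsCube-cube Unit-6) IsCube-18

  S : List ℕ
  S = 1 ∷ 3 ∷ 4 ∷ []

  S⇒Unit : ∀ {t} → t ∈ S → Unit t
  S⇒Unit (here refl)                 = Unit-1
  S⇒Unit (there (here refl))         = Unit-3
  S⇒Unit (there (there (here refl))) = Unit-4

  cofactor : ∀ {d} s t → IsCube (d * s) → IsCube (s * t) → ∃ λ c → IsCube c × c * t ≈ d
  cofactor {d} s t ds st = d * s * inv (s * t) , IsCube-* ds (IsCube-inv st) , (begin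
    d * s * inv (s * t) * t    ≡⟨ rearrange d s (inv (s * t)) t ⟩
    d * (s * t * inv (s * t))  ≈⟨ *-congˡ d (*-inverseʳ (IsCube⇒Unit st)) ⟩
    d * 1                      ≡⟨ *-identityʳ d ⟩
    d                          ∎)
    where
    rearrange : ∀ d s i t → d * s * i * t ≡ d * (s * t * i)
    rearrange = solve-∀

  S-covers : ∀ {d} → Unit d → ∃₂ λ c t → IsCube c × t ∈ S × c * t ≈ d
  S-covers {d} ud with IsCube? d | IsCube? (d * 3)
  ... | yes cd | _      = d , 1 , cd , here refl , ≡⇒≈ (*-identityʳ d)
  ... | no _   | yes c3d = let (c , cc , ct≈d) = cofactor 3 4 c3d IsCube-12
                           in c , 4 , cc , there (there (here refl)) , ct≈d
  ... | no ¬cd | no ¬c3d = let (c , cc , ct≈d) = cofactor (3 * 3) 3 c9d (IsCube-cube Unit-3)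
                           in c , 3 , cc , there (here refl) , ct≈d
    where
    c9d : IsCube (d * (3 * 3))
    c9d = cubeIndex≤3 ud Unit-3 ¬cd (noncube ¬3) ¬c3d

  ¬IsCube-*cube : ∀ {a b} → ¬ IsCube a → Unit b → ¬ IsCube (a * cube b)
  ¬IsCube-*cube ¬a ub = ¬a ∘ flip IsCube-/ (IsCube-cube ub)

  ratio-noncube : ∀ {t t′} → t ∈ S → t′ ∈ S → IsCube (t * (t′ * t′)) → t ≡ t′
  ratio-noncube (here refl)                 (here refl)                 _ = refl
  ratio-noncube (there (here refl))         (there (here refl))         _ = refl
  ratio-noncube (there (there (here refl))) (there (there (here refl))) _ = refl
  ratio-noncube (here refl)                 (there (here refl))         c =
    contradiction c (¬IsCube-square (noncube ¬3))
  ratio-noncube (here refl)                 (there (there (here refl))) c =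
    contradiction c (¬IsCube-*cube (noncube ¬2) Unit-2)
  ratio-noncube (there (here refl))         (here refl)                 c =
    contradiction c (noncube ¬3)
  ratio-noncube (there (here refl))         (there (there (here refl))) c =
    contradiction c (¬IsCube-*cube (noncube ¬6) Unit-2)
  ratio-noncube (there (there (here refl))) (here refl)                 c =
    contradiction c (¬IsCube-square (noncube ¬2))
  ratio-noncube (there (there (here refl))) (there (here refl))         c =
    contradiction c (¬IsCube-square (noncube ¬6))

  S-separates : ∀ {c c′ t t′} → IsCube c → IsCube c′ → t ∈ S → t′ ∈ S → c * t ≈ c′ * t′ → t ≡ t′
  S-separates {c} {c′} {t} {t′} cc cc′ t∈S t′∈S e = ratio-noncube t∈S t′∈S
    (IsCube-/ (IsCube-≡ (*-comm c _) (IsCube-resp (≈-sym (begin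
      c * (t * (t′ * t′))   ≡⟨ *-assoc c t (t′ * t′) ⟨
      c * t * (t′ * t′)     ≈⟨ *-congʳ (t′ * t′) e ⟩
      c′ * t′ * (t′ * t′)   ≡⟨ rearrange c′ t′ ⟩
      c′ * cube t′          ∎)) (IsCube-* cc′ (IsCube-cube (S⇒Unit t′∈S))))) cc)
    where
    rearrange : ∀ c t → c * t * (t * t) ≡ c * (t * t * t)
    rearrange = solve-∀

  factorisation : Factorisation p (Cay p S)
  factorisation = TransversalFactorisation.factorisation IsCube IsCube? IsCube-resp IsCube⇒Unit IsCube-neg
    S S⇒Unit S-covers S-separates (%6≡1⇒odd {p} p%6≡1)

theorem4 : (p : ℕ) .{{_ : NonZero p}} → Prime p → p % 6 ≡ 1 →
    ¬ IsUnitCube p 2 → ¬ IsUnitCube p 3 → ¬ IsUnitCube p 6 →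
    Factorisation p (Cay p (1 ∷ 3 ∷ 4 ∷ []))
theorem4 = CubeTransversal.factorisation
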